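{- Let $d\ge 1$ and let $H$ be an octahedral system on $\mathbf{S}=\bigcup_{i=0}^d\mathbf{S}_i$. Let $e$ be a colourful edge (a set containing exactly one point of each $\mathbf{S}_i$), and let $H'$ be obtained from $H$ by adding $e$ (if $e\notin H$) or deleting $e$ (if $e\in H$). Then the score of $H'$ differs from the score of $H$ by at most $d^{z(e)}$, where $z(e)$ is the number of points of $e$ labelled $0$.
   Context: Setting: $\mathbf{S}_0,\ldots,\mathbf{S}_d$ are disjoint sets ("colours") of $d+1$ points each; the points of each $\mathbf{S}_i$ are labelled $0,1,\ldots,d$. A hypergraph on $\mathbf{S}=\bigcup_i \mathbf{S}_i$ whose edges each contain exactly one point of each $\mathbf{S}_i$ is written with edges as strings $x_0x_1\cdots x_d$ ($x_i$ the label of the point of colour $i$). For a colour $i$, an $\widehat{i}$-transversal is a set of $d$ points containing exactly one point of each $\mathbf{S}_j$, $j\ne i$, and none of $\mathbf{S}_i$; an $\widehat{i}$-octahedron $\Omega$ is a pair of disjoint $\widehat{i}$-transversals (viewed as the union of their $2d$ points). The hypergraph is an octahedral system if for every colour $i$, every $\widehat{i}$-octahedron $\Omega$, the parity of the number of edges $e$ with $e\cap\mathbf{S}_i=\{s\}$ and $e\setminus\{s\}\subseteq\Omega$ is the same for all $s\in\mathbf{S}_i$. Score: fix colour $0$ and the $\widehat{0}$-transversal $t_0=\ast 00\cdots0$ (the points labelled $0$ of colours $1,\ldots,d$). The $d^d$ octahedra containing $t_0$ are $t_0\cup t$ with $t=\ast t_1\cdots t_d$, all $t_j\in\{1,\ldots,d\}$.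 The large table has rows indexed by these $t$ and columns by $x\in\{0,\ldots,d\}$ (points of colour 0); its entry $(t,x)$ is the parity of the number of edges $x\,y_1\cdots y_d$ of the hypergraph with $y_j\in\{0,t_j\}$ for all $j$. The score of the hypergraph is the number of entries $(t,x)$ with $x\neq 0$ whose value differs from the entry $(t,0)$. -}

module Defs where

open import Data.Nat using (ℕ; zero; suc; _+_; _%_; _≡ᵇ_)
open import Data.Bool using (Bool; true; false; if_then_else_; not; _∧_; _∨_)
open import Data.Fin using (Fin; zero; suc)
open import Data.Fin.Properties using (_≟_)
open import Data.Vec using (Vec; []; _∷_; lookup; toList)
open import Data.Vec.Properties using (≡-dec)
open import Data.List using (List; []; _∷_; map; concatMap; allFin)
open import Data.Bool.ListAction using (all)
open import Data.Nat.ListAction using (sum)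
open import Relation.Nullary.Decidable using (⌊_⌋)
open import Relation.Binary.PropositionalEquality using (_≡_; _≢_)

allVecs : ∀ {m} n → List (Vec (Fin m) n)
allVecs zero = [] ∷ []
allVecs {m} (suc n) = concatMap (λ x → map (x ∷_) (allVecs n)) (allFin m)

countB : {A : Set} → (A → Bool) → List A → ℕ
countB p [] = 0
countB p (x ∷ xs) = (if p x then 1 else 0) + countB p xs

allB : ∀ {n} → (Fin n → Bool) → Bool
allB {n} p = all p (allFin n)

-- Colours and labels are both Fin (suc d).  A colourful edge x₀x₁⋯x_d is a
-- vector whose i-th entry is the label of its point of colour i.
Edge : ℕ → Set
Edge d = Vec (Fin (suc d)) (suc d)

Hypergraph : ℕ → Set
Hypergraph d = Edge d → Bool

-- An î-octahedron is given by two î-transversals a, b (the i-th entries of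
-- the vectors a, b are ignored).  Disjointness: a j ≠ b j for all j ≠ i.
DisjointTransversals : ∀ {d} → Fin (suc d) → Edge d → Edge d → Set
DisjointTransversals i a b = ∀ j → j ≢ i → lookup a j ≢ lookup b j

insideΩ : ∀ {d} → Fin (suc d) → Edge d → Edge d → Edge d → Bool
insideΩ i a b e =
  allB (λ j → ⌊ j ≟ i ⌋ ∨ ⌊ lookup e j ≟ lookup a j ⌋ ∨ ⌊ lookup e j ≟ lookup b j ⌋)

octCount : ∀ {d} → Hypergraph d → Fin (suc d) → Edge d → Edge d → Fin (suc d) → ℕ
octCount {d} H i a b s =
  countB (λ e → H e ∧ ⌊ lookup e i ≟ s ⌋ ∧ insideΩ i a b e) (allVecs (suc d))

IsOctahedral : ∀ {d} → Hypergraph d → Set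
IsOctahedral {d} H =
  ∀ (i : Fin (suc d)) (a b : Edge d) → DisjointTransversals i a b →
  ∀ (s s′ : Fin (suc d)) → octCount H i a b s % 2 ≡ octCount H i a b s′ % 2

-- entry (t,x) of the large table; t = t₁⋯t_d with t_j ∈ {1,…,d},
-- encoded as t : Vec (Fin d) d with label t_j = suc (lookup t j).
entry : ∀ {d} → Hypergraph d → Vec (Fin d) d → Fin (suc d) → ℕ
entry {d} H t x =
  countB (λ ys → H (x ∷ ys) ∧
                 allB (λ j → ⌊ lookup ys j ≟ zero ⌋ ∨ ⌊ lookup ys j ≟ suc (lookup t j) ⌋))
         (allVecs d) % 2

score : ∀ {d} → Hypergraph d → ℕ
score {d} H =
  sum (map (λ t → countB (λ x → not ⌊ x ≟ zero ⌋ ∧ not (entry H t x ≡ᵇ entry H t zero))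
                         (allFin (suc d)))
           (allVecs d))

toggle : ∀ {d} → Hypergraph d → Edge d → Hypergraph d
toggle H e f = if ⌊ ≡-dec _≟_ e f ⌋ then not (H f) else H f

zeros : ∀ {d} → Edge d → ℕ
zeros e = countB (λ x → ⌊ x ≟ zero ⌋) (toList e)

module Submission where

-- In an octahedral system every row of the large table is constant:
-- the entry (t,x) is the parity of the number of edges through x inside the
-- 0̂-octahedron t₀ ∪ t, and octahedrality says this parity does not depend on x.
-- Hence score H = 0, and it suffices to show score H' ≤ d^z(e) for H' obtained
-- by toggling e = x₀y₁⋯y_d.  Toggling e only changes the entries (t,x₀) of the
-- rows t "compatible" with e (y_j ∈ {0,t_j} for all j).  A constant row changed
-- in column x₀ has at most w(x₀) entries differing from column 0, where
-- w(0) = d and w(x₀) = 1 otherwise; and there are at most d^z(y) compatible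
-- rows, because each y_j = 0 leaves d choices of t_j and each y_j ≠ 0 at most
-- one.  Since w(x₀)·d^z(y) = d^z(e), the bound follows.

open import Defs
open import Data.Nat using (ℕ; zero; suc; _+_; _*_; _^_; _≤_; z≤n; s≤s; _%_; _≡ᵇ_)
open import Data.Nat.Properties
  using (≤-refl; ≤-trans; ≤-reflexive; m≤n⇒m≤1+n; +-assoc; +-identityʳ; +-mono-≤; *-mono-≤; *-monoˡ-≤; *-comm; *-identityʳ;
         ^-distribˡ-+-*; ≡⇒≡ᵇ; module ≤-Reasoning)
open import Data.Nat.ListAction using (sum)
open import Data.Bool using (Bool; true; false; if_then_else_; not; _∧_; _∨_)
open import Data.Bool.Properties using (∧-zeroʳ; T-≡)
open import Data.Bool.ListAction using (all; and)
open import Data.Fin using (Fin; zero; suc)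
open import Data.Fin.Properties using (_≟_; suc-injective)
open import Data.Vec using (Vec; []; _∷_; lookup; replicate; toList) renaming (map to mapᵥ)
open import Data.Vec.Properties using (≡-dec; lookup-replicate; lookup-map; ∷-injectiveˡ; ∷-injectiveʳ)
open import Data.List using (List; []; _∷_; _++_; map; concatMap; allFin; length)
open import Data.List.Properties using (map-tabulate; map-∘; map-cong; length-tabulate)
open import Data.Product using (_×_; _,_)
open import Data.Empty using (⊥-elim)
open import Function using (_∘_)
open import Function.Bundles using (Equivalence)
open import Relation.Nullary using (¬_; Dec; yes; no)
open import Relation.Nullary.Decidable using (⌊_⌋; toWitness; isYes≗does; dec-true; dec-false)
open import Relation.Binary.PropositionalEquality

private variable
  A B : Set
  m n : ℕ

⌊⌋-true : (a? : Dec A) → A → ⌊ a? ⌋ ≡ true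
⌊⌋-true a? a = trans (isYes≗does a?) (dec-true a? a)

⌊⌋-false : (a? : Dec A) → ¬ A → ⌊ a? ⌋ ≡ false
⌊⌋-false a? ¬a = trans (isYes≗does a?) (dec-false a? ¬a)

⌊⌋-sound : (a? : Dec A) → ⌊ a? ⌋ ≡ true → A
⌊⌋-sound a? eq = toWitness (Equivalence.from T-≡ eq)

differs-equal : ∀ {k l} → k ≡ l → not (k ≡ᵇ l) ≡ false
differs-equal {k} {l} eq = cong not (Equivalence.to T-≡ (≡⇒≡ᵇ k l eq))

countB-cong : ∀ {p q : A → Bool} (L : List A) → (∀ a → p a ≡ q a) → countB p L ≡ countB q L
countB-cong [] h = refl
countB-cong (x ∷ L) h = cong₂ (λ b k → (if b then 1 else 0) + k) (h x) (countB-cong L h)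

countB-false : ∀ {p : A → Bool} (L : List A) → (∀ a → p a ≡ false) → countB p L ≡ 0
countB-false [] h = refl
countB-false (x ∷ L) h rewrite h x = countB-false L h

countB-≤-length : ∀ (p : A → Bool) L → countB p L ≤ length L
countB-≤-length p [] = z≤n
countB-≤-length p (x ∷ L) with p x
... | true = s≤s (countB-≤-length p L)
... | false = m≤n⇒m≤1+n (countB-≤-length p L)

countB-++ : ∀ (p : A → Bool) xs ys → countB p (xs ++ ys) ≡ countB p xs + countB p ys
countB-++ p [] ys = refl
countB-++ p (x ∷ xs) ys =
  trans (cong ((if p x then 1 else 0) +_) (countB-++ p xs ys))
        (sym (+-assoc (if p x then 1 else 0) (countB p xs) (countB p ys)))

countB-map : ∀ (p : B → Bool) (f : A → B) L → countB p (map f L) ≡ countB (p ∘ f) L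
countB-map p f [] = refl
countB-map p f (x ∷ L) = cong (_ +_) (countB-map p f L)

countB-concatMap : ∀ (p : B → Bool) (f : A → List B) L →
                   countB p (concatMap f L) ≡ sum (map (countB p ∘ f) L)
countB-concatMap p f [] = refl
countB-concatMap p f (x ∷ L) =
  trans (countB-++ p (f x) (concatMap f L)) (cong (countB p (f x) +_) (countB-concatMap p f L))

sum-indicator : ∀ (p : A → Bool) c L → sum (map (λ a → if p a then c else 0) L) ≡ countB p L * c
sum-indicator p c [] = refl
sum-indicator p c (x ∷ L) with p x
... | true = cong (c +_) (sum-indicator p c L)
... | false = sum-indicator p c L

countB-mono : ∀ {p q : A → Bool} (L : List A) → (∀ a → p a ≡ true → q a ≡ true) → countB p L ≤ countB q L
countB-mono [] h = z≤n
countB-mono {p = p} {q} (x ∷ L) h with p x in px | q x in qx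
... | true  | true  = s≤s (countB-mono L h)
... | true  | false with () ← trans (sym (h x px)) qx
... | false | true  = m≤n⇒m≤1+n (countB-mono L h)
... | false | false = countB-mono L h

sum-zero : ∀ (f : A → ℕ) L → (∀ a → f a ≡ 0) → sum (map f L) ≡ 0
sum-zero f [] h = refl
sum-zero f (x ∷ L) h rewrite h x = sum-zero f L h

sum-mono : ∀ (f g : A → ℕ) L → (∀ a → f a ≤ g a) → sum (map f L) ≤ sum (map g L)
sum-mono f g [] h = z≤n
sum-mono f g (x ∷ L) h = +-mono-≤ (h x) (sum-mono f g L h)

allFin-suc : ∀ n → allFin (suc n) ≡ zero ∷ map suc (allFin n)
allFin-suc n = cong (zero ∷_) (sym (map-tabulate (λ x → x) suc))

countB-allFin-suc : ∀ (p : Fin (suc n) → Bool) →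
                    countB p (allFin (suc n)) ≡ (if p zero then 1 else 0) + countB (p ∘ suc) (allFin n)
countB-allFin-suc {n} p =
  trans (cong (countB p) (allFin-suc n)) (cong ((if p zero then 1 else 0) +_) (countB-map p suc (allFin n)))

sum-allFin-suc : ∀ (f : Fin (suc n) → ℕ) →
                 sum (map f (allFin (suc n))) ≡ f zero + sum (map (f ∘ suc) (allFin n))
sum-allFin-suc {n} f =
  trans (cong (sum ∘ map f) (allFin-suc n)) (cong (λ L → f zero + sum L) (sym (map-∘ (allFin n))))

allB-suc : ∀ (p : Fin (suc n) → Bool) → allB p ≡ p zero ∧ allB (p ∘ suc)
allB-suc {n} p =
  trans (cong (all p) (allFin-suc n)) (cong (λ L → p zero ∧ and L) (sym (map-∘ (allFin n))))

allB-cong : ∀ {p q : Fin n → Bool} → (∀ j → p j ≡ q j) → allB p ≡ allB q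
allB-cong {n} h = cong and (map-cong h (allFin n))

countB-allFin-≤-n : ∀ (p : Fin n → Bool) → countB p (allFin n) ≤ n
countB-allFin-≤-n {n} p = ≤-trans (countB-≤-length p (allFin n)) (≤-reflexive (length-tabulate (λ x → x)))

sum-allFin-single : ∀ (f : Fin n → ℕ) s → (∀ x → x ≢ s → f x ≡ 0) → sum (map f (allFin n)) ≡ f s
sum-allFin-single {suc n} f zero off =
  trans (sum-allFin-suc f)
        (trans (cong (f zero +_) (sum-zero (f ∘ suc) (allFin n) (λ x → off (suc x) (λ ()))))
               (+-identityʳ (f zero)))
sum-allFin-single {suc n} f (suc s) off =
  trans (sum-allFin-suc f)
        (trans (cong (_+ sum (map (f ∘ suc) (allFin n))) (off zero λ ()))
               (sum-allFin-single (f ∘ suc) s (λ x x≢s → off (suc x) (x≢s ∘ suc-injective))))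

countB-allFin-point : ∀ (k : Fin n) → countB (λ x → ⌊ x ≟ k ⌋) (allFin n) ≡ 1
countB-allFin-point {n} k = begin
  countB isK (allFin n)                               ≡⟨ *-identityʳ _ ⟨
  countB isK (allFin n) * 1                           ≡⟨ sum-indicator isK 1 (allFin n) ⟨
  sum (map (λ x → if isK x then 1 else 0) (allFin n)) ≡⟨ sum-allFin-single _ k off ⟩
  (if isK k then 1 else 0)                            ≡⟨ cong (λ b → if b then 1 else 0) (⌊⌋-true (k ≟ k) refl) ⟩
  1                                                   ∎
  where
  open ≡-Reasoning
  isK : Fin n → Bool
  isK x = ⌊ x ≟ k ⌋
  off : ∀ x → x ≢ k → (if isK x then 1 else 0) ≡ 0
  off x x≢k = cong (λ b → if b then 1 else 0) (⌊⌋-false (x ≟ k) x≢k)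

countB-allFin-≤1 : ∀ (p : Fin n → Bool) (k : Fin n) → (∀ x → p x ≡ true → x ≡ k) → countB p (allFin n) ≤ 1
countB-allFin-≤1 {n} p k only =
  ≤-trans (countB-mono (allFin n) (λ x px → ⌊⌋-true (x ≟ k) (only x px))) (≤-reflexive (countB-allFin-point k))

countB-allVecs-suc : ∀ (P : Vec (Fin m) (suc n) → Bool) →
  countB P (allVecs (suc n)) ≡ sum (map (λ x → countB (λ ys → P (x ∷ ys)) (allVecs n)) (allFin m))
countB-allVecs-suc {m} {n} P =
  trans (countB-concatMap P (λ x → map (x ∷_) (allVecs n)) (allFin m))
        (cong sum (map-cong (λ x → countB-map P (x ∷_) (allVecs n)) (allFin m)))

countB-allVecs-fibre : ∀ (P : Vec (Fin m) (suc n) → Bool) (s : Fin m) →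
  (∀ x ys → x ≢ s → P (x ∷ ys) ≡ false) →
  countB P (allVecs (suc n)) ≡ countB (λ ys → P (s ∷ ys)) (allVecs n)
countB-allVecs-fibre {n = n} P s off =
  trans (countB-allVecs-suc P)
        (sum-allFin-single _ s (λ x x≢s → countB-false (allVecs n) (λ ys → off x ys x≢s)))

countB-∧ˡ : ∀ b (r : A → Bool) L → countB (λ a → b ∧ r a) L ≡ (if b then countB r L else 0)
countB-∧ˡ true r L = refl
countB-∧ˡ false r L = countB-false L (λ _ → refl)

countB-allVecs-product : ∀ (P : Vec (Fin m) (suc n) → Bool) (q : Fin m → Bool) (r : Vec (Fin m) n → Bool) →
  (∀ x ys → P (x ∷ ys) ≡ q x ∧ r ys) →
  countB P (allVecs (suc n)) ≡ countB q (allFin m) * countB r (allVecs n)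
countB-allVecs-product {m} {n} P q r split = begin
  countB P (allVecs (suc n))                                          ≡⟨ countB-allVecs-suc P ⟩
  sum (map (λ x → countB (λ ys → P (x ∷ ys)) (allVecs n)) (allFin m)) ≡⟨ cong sum (map-cong fibre (allFin m)) ⟩
  sum (map (λ x → if q x then countB r (allVecs n) else 0) (allFin m)) ≡⟨ sum-indicator q _ (allFin m) ⟩
  countB q (allFin m) * countB r (allVecs n)                          ∎
  where
  open ≡-Reasoning
  fibre : ∀ x → countB (λ ys → P (x ∷ ys)) (allVecs n) ≡ (if q x then countB r (allVecs n) else 0)
  fibre x = trans (countB-cong (allVecs n) (split x)) (countB-∧ˡ (q x) r (allVecs n))

compatible : ∀ {d n} → Vec (Fin (suc d)) n → Vec (Fin d) n → Bool
compatible ys t = allB (λ j → ⌊ lookup ys j ≟ zero ⌋ ∨ ⌊ lookup ys j ≟ suc (lookup t j) ⌋)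

tableCount : ∀ {d} → Hypergraph d → Vec (Fin d) d → Fin (suc d) → ℕ
tableCount {d} H t x = countB (λ ys → H (x ∷ ys) ∧ compatible ys t) (allVecs d)

defect : ∀ {d} → (Fin (suc d) → ℕ) → ℕ
defect {d} f = countB (λ x → not ⌊ x ≟ zero ⌋ ∧ not (f x ≡ᵇ f zero)) (allFin (suc d))

defect-nonzero-columns : ∀ {d} (f : Fin (suc d) → ℕ) →
  defect f ≡ countB (λ x → not (f (suc x) ≡ᵇ f zero)) (allFin d)
defect-nonzero-columns f = countB-allFin-suc (λ x → not ⌊ x ≟ zero ⌋ ∧ not (f x ≡ᵇ f zero))

defect-constant : ∀ {d} (f : Fin (suc d) → ℕ) v → (∀ x → f x ≡ v) → defect f ≡ 0
defect-constant {d} f v const =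
  trans (defect-nonzero-columns f)
        (countB-false (allFin d) (λ x → differs-equal (trans (const (suc x)) (sym (const zero)))))

-- A change in column c can make at most columnWeight c entries differ from column 0.
columnWeight : ∀ {d} → Fin (suc d) → ℕ
columnWeight {d} zero = d
columnWeight (suc _) = 1

-- A row that is constant outside column c has defect at most columnWeight c:
-- for c = 0 every nonzero column may differ, otherwise only column c can.
defect-single-column : ∀ {d} (f : Fin (suc d) → ℕ) c v → (∀ x → x ≢ c → f x ≡ v) → defect f ≤ columnWeight c
defect-single-column f zero v _ = ≤-trans (≤-reflexive (defect-nonzero-columns f)) (countB-allFin-≤-n _)
defect-single-column f (suc k) v agree =
  ≤-trans (≤-reflexive (defect-nonzero-columns f)) (countB-allFin-≤1 _ k only)
  where
  only : ∀ x → not (f (suc x) ≡ᵇ f zero) ≡ true → x ≡ k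
  only x differs with x ≟ k
  ... | yes x≡k = x≡k
  ... | no x≢k with () ← trans (sym differs)
                           (differs-equal (trans (agree (suc x) (x≢k ∘ suc-injective)) (sym (agree zero λ ()))))

-- The 0̂-octahedron t₀ ∪ t is spanned by the transversals 0⋯0 and t
-- (their colour-0 entries are ignored).
baseTransversal : ∀ {d} → Edge d
baseTransversal {d} = replicate (suc d) zero

rowTransversal : ∀ {d} → Vec (Fin d) d → Edge d
rowTransversal t = zero ∷ mapᵥ suc t

rowOctahedron-disjoint : ∀ {d} (t : Vec (Fin d) d) → DisjointTransversals zero baseTransversal (rowTransversal t)
rowOctahedron-disjoint t zero 0≢0 = ⊥-elim (0≢0 refl)
rowOctahedron-disjoint {d} t (suc k) _ same
  with () ← trans (sym (lookup-replicate k (zero {d}))) (trans same (lookup-map k suc t))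

inside-rowOctahedron : ∀ {d} (t : Vec (Fin d) d) s ys →
  insideΩ zero baseTransversal (rowTransversal t) (s ∷ ys) ≡ compatible ys t
inside-rowOctahedron {d} t s ys =
  trans (allB-suc inΩ) (allB-cong λ k →
    cong₂ (λ u v → ⌊ lookup ys k ≟ u ⌋ ∨ ⌊ lookup ys k ≟ v ⌋) (lookup-replicate k zero) (lookup-map k suc t))
  where
  inΩ : Fin (suc d) → Bool
  inΩ j = ⌊ j ≟ zero ⌋ ∨ ⌊ lookup (s ∷ ys) j ≟ lookup baseTransversal j ⌋
                      ∨ ⌊ lookup (s ∷ ys) j ≟ lookup (rowTransversal t) j ⌋

octCount-rowOctahedron : ∀ {d} (H : Hypergraph d) t s →
  octCount H zero baseTransversal (rowTransversal t) s ≡ tableCount H t s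
octCount-rowOctahedron {d} H t s =
  trans (countB-allVecs-fibre _ s off)
        (countB-cong (allVecs d) λ ys →
          cong₂ (λ b c → H (s ∷ ys) ∧ b ∧ c) (⌊⌋-true (s ≟ s) refl) (inside-rowOctahedron t s ys))
  where
  off : ∀ x ys → x ≢ s →
        H (x ∷ ys) ∧ ⌊ x ≟ s ⌋ ∧ insideΩ zero baseTransversal (rowTransversal t) (x ∷ ys) ≡ false
  off x ys x≢s =
    trans (cong (λ b → H (x ∷ ys) ∧ b ∧ insideΩ zero baseTransversal (rowTransversal t) (x ∷ ys))
                (⌊⌋-false (x ≟ s) x≢s))
          (∧-zeroʳ (H (x ∷ ys)))

-- Octahedrality on t₀ ∪ t says that the parities tableCount H t x % 2 agree for all x.
rows-constant : ∀ {d} (H : Hypergraph d) → IsOctahedral H → ∀ t x → entry H t x ≡ entry H t zero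
rows-constant H oct t x = begin
  tableCount H t x % 2                                                ≡⟨ cong (_% 2) (octCount-rowOctahedron H t x) ⟨
  octCount H zero baseTransversal (rowTransversal t) x % 2            ≡⟨ oct zero baseTransversal (rowTransversal t) (rowOctahedron-disjoint t) x zero ⟩
  octCount H zero baseTransversal (rowTransversal t) zero % 2         ≡⟨ cong (_% 2) (octCount-rowOctahedron H t zero) ⟩
  tableCount H t zero % 2                                             ∎
  where open ≡-Reasoning

octahedral-score-zero : ∀ {d} (H : Hypergraph d) → IsOctahedral H → score H ≡ 0
octahedral-score-zero {d} H oct =
  sum-zero _ (allVecs d) (λ t → defect-constant (entry H t) _ (rows-constant H oct t))

entry-toggle-unseen : ∀ {d} (H : Hypergraph d) e t x →
  (∀ ys → x ∷ ys ≡ e → compatible ys t ≡ false) → entry (toggle H e) t x ≡ entry H t x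
entry-toggle-unseen {d} H e t x unseen = cong (_% 2) (countB-cong (allVecs d) same)
  where
  same : ∀ ys → toggle H e (x ∷ ys) ∧ compatible ys t ≡ H (x ∷ ys) ∧ compatible ys t
  same ys with ≡-dec _≟_ e (x ∷ ys)
  ... | no _ = refl
  ... | yes e≡ rewrite unseen ys (sym e≡) = trans (∧-zeroʳ _) (sym (∧-zeroʳ _))

-- In the toggled system, a row not compatible with y stays constant, and a
-- compatible row is a constant row changed in column x₀ only.
toggled-row-defect : ∀ {d} (H : Hypergraph d) → IsOctahedral H → ∀ x₀ y t →
  defect (entry (toggle H (x₀ ∷ y)) t) ≤ (if compatible y t then columnWeight x₀ else 0)
toggled-row-defect H oct x₀ y t with compatible y t in compat
... | false = ≤-reflexive (defect-constant _ _ λ x →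
        unchanged x λ ys eq → trans (cong (λ zs → compatible zs t) (∷-injectiveʳ eq)) compat)
  where
  unchanged : ∀ x → (∀ ys → x ∷ ys ≡ x₀ ∷ y → compatible ys t ≡ false) →
              entry (toggle H (x₀ ∷ y)) t x ≡ entry H t zero
  unchanged x unseen = trans (entry-toggle-unseen H _ t x unseen) (rows-constant H oct t x)
... | true = defect-single-column _ x₀ _ λ x x≢x₀ →
        trans (entry-toggle-unseen H _ t x λ _ eq → ⊥-elim (x≢x₀ (∷-injectiveˡ eq))) (rows-constant H oct t x)

zeroCount : ∀ {d n} → Vec (Fin (suc d)) n → ℕ
zeroCount y = countB (λ x → ⌊ x ≟ zero ⌋) (toList y)

choices : ∀ {d} → Fin (suc d) → Fin d → Bool
choices y₀ x = ⌊ y₀ ≟ zero ⌋ ∨ ⌊ y₀ ≟ suc x ⌋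

choices-bound : ∀ {d} (y₀ : Fin (suc d)) → countB (choices y₀) (allFin d) ≤ d ^ (if ⌊ y₀ ≟ zero ⌋ then 1 else 0)
choices-bound {d} zero = ≤-trans (countB-allFin-≤-n _) (≤-reflexive (sym (*-identityʳ d)))
choices-bound (suc k) = countB-allFin-≤1 _ k λ x chosen → suc-injective (sym (⌊⌋-sound (suc k ≟ suc x) chosen))

-- The compatible rows t form a product of the admissible labels of each
-- position, so there are at most d^z(y) of them.
compatible-count : ∀ {d n} (y : Vec (Fin (suc d)) n) → countB (compatible y) (allVecs n) ≤ d ^ zeroCount y
compatible-count [] = ≤-refl
compatible-count {d} {suc n} (y₀ ∷ y) = begin
  countB (compatible (y₀ ∷ y)) (allVecs (suc n))
    ≡⟨ countB-allVecs-product _ (choices y₀) (compatible y) (λ x t → allB-suc (compatibleAt x t)) ⟩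
  countB (choices y₀) (allFin d) * countB (compatible y) (allVecs n)
    ≤⟨ *-mono-≤ (choices-bound y₀) (compatible-count y) ⟩
  d ^ (if ⌊ y₀ ≟ zero ⌋ then 1 else 0) * d ^ zeroCount y
    ≡⟨ ^-distribˡ-+-* d (if ⌊ y₀ ≟ zero ⌋ then 1 else 0) (zeroCount y) ⟨
  d ^ zeroCount (y₀ ∷ y)
    ∎
  where
  open ≤-Reasoning
  compatibleAt : Fin d → Vec (Fin d) n → Fin (suc n) → Bool
  compatibleAt x t j = ⌊ lookup (y₀ ∷ y) j ≟ zero ⌋ ∨ ⌊ lookup (y₀ ∷ y) j ≟ suc (lookup (x ∷ t) j) ⌋

-- w(x₀) · d^z(y) = d^z(x₀ ∷ y), since x₀ = 0 contributes one extra zero.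
columnWeight-power : ∀ {d} (x₀ : Fin (suc d)) (y : Vec (Fin (suc d)) d) →
  d ^ zeroCount y * columnWeight x₀ ≡ d ^ zeros (x₀ ∷ y)
columnWeight-power {d} zero y = *-comm (d ^ zeroCount y) d
columnWeight-power (suc _) y = *-identityʳ _

toggled-score : ∀ {d} (H : Hypergraph d) → IsOctahedral H → ∀ x₀ y →
  score (toggle H (x₀ ∷ y)) ≤ d ^ zeros (x₀ ∷ y)
toggled-score {d} H oct x₀ y = begin
  score (toggle H (x₀ ∷ y))
    ≤⟨ sum-mono _ _ (allVecs d) (toggled-row-defect H oct x₀ y) ⟩
  sum (map (λ t → if compatible y t then columnWeight x₀ else 0) (allVecs d))
    ≡⟨ sum-indicator (compatible y) (columnWeight x₀) (allVecs d) ⟩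
  countB (compatible y) (allVecs d) * columnWeight x₀
    ≤⟨ *-monoˡ-≤ (columnWeight x₀) (compatible-count y) ⟩
  d ^ zeroCount y * columnWeight x₀
    ≡⟨ columnWeight-power x₀ y ⟩
  d ^ zeros (x₀ ∷ y)
    ∎
  where open ≤-Reasoning

-- The theorem: score H = 0, so both bounds reduce to score H' ≤ d^z(e).
-- The argument does not need the hypothesis d ≥ 1.

lemma1 : ∀ (d : ℕ) → 1 ≤ d → (H : Hypergraph d) → IsOctahedral H → (e : Edge d) →
         (score (toggle H e) ≤ score H + d ^ zeros e) × (score H ≤ score (toggle H e) + d ^ zeros e)
lemma1 d _ H oct (x₀ ∷ y) rewrite octahedral-score-zero H oct = toggled-score H oct x₀ y , z≤n
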